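{- Let $D$ be a digraph. Then $\langle D\rangle$ is $\mathscr{H}$-trivial if and only if every strong component of $D$ is a path, i.e. each strong component, with vertex set $\{v_1,\ldots,v_m\}$ in a suitable order, has as its arcs exactly $(v_i,v_{i+1})$ and $(v_{i+1},v_i)$ for $1\le i\le m-1$ (a single vertex counts as a path).
   Context: For $a\neq b$ in $\{1,\ldots,n\}$, $(a\to b)$ denotes the transformation of $\{1,\ldots,n\}$ mapping $a$ to $b$ and fixing every other point; transformations are composed left to right. For a digraph $D$ on $\{1,\ldots,n\}$ (no loops, no multiple arcs), $\langle D\rangle$ is the semigroup generated by all $(a\to b)$ with $(a,b)$ an arc of $D$. The strong component of a vertex $v$ is the subdigraph induced by the vertices $u$ such that there are directed paths from $u$ to $v$ and from $v$ to $u$. A semigroup is $\mathscr{H}$-trivial if any two $\mathscr{H}$-related elements (Green's $\mathscr{H}$-relation) are equal. -}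

module Defs where

open import Data.Nat using (ℕ; suc)
open import Data.Fin using (Fin; toℕ; _≟_)
open import Data.Bool using (Bool; true; false)
open import Data.Product using (Σ; _×_; _,_; ∃)
open import Data.Sum using (_⊎_)
open import Relation.Nullary using (¬_; yes; no)
open import Relation.Binary.PropositionalEquality using (_≡_)
open import Relation.Binary.Construct.Closure.ReflexiveTransitive using (Star)
open import Function using (_⇔_)

record Digraph (n : ℕ) : Set where
  field
    adj     : Fin n → Fin n → Bool
    noLoops : ∀ a → adj a a ≡ false

Arc : ∀ {n} → Digraph n → Fin n → Fin n → Set
Arc D a b = Digraph.adj D a b ≡ true

Transf : ℕ → Set
Transf n = Fin n → Fin n

_≈_ : ∀ {n} → Transf n → Transf n → Set
f ≈ g = ∀ x → f x ≡ g x

_⨾_ : ∀ {n} → Transf n → Transf n → Transf n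
(f ⨾ g) x = g (f x)

elem : ∀ {n} → Fin n → Fin n → Transf n
elem a b x with x ≟ a
... | yes _ = b
... | no  _ = x

data Gen {n} (D : Digraph n) : Transf n → Set where
  gen  : ∀ {a b} → Arc D a b → Gen D (elem a b)
  comp : ∀ {f g} → Gen D f → Gen D g → Gen D (f ⨾ g)

_∈⟨_⟩ : ∀ {n} → Transf n → Digraph n → Set
t ∈⟨ D ⟩ = ∃ λ f → Gen D f × (f ≈ t)

-- Green's relations in S = ⟨D⟩: a R b iff aS¹ = bS¹, a L b iff S¹a = S¹b.
≤R : ∀ {n} → Digraph n → Transf n → Transf n → Set
≤R D a b = (a ≈ b) ⊎ (∃ λ s → s ∈⟨ D ⟩ × (a ≈ (b ⨾ s)))

≤L : ∀ {n} → Digraph n → Transf n → Transf n → Set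
≤L D a b = (a ≈ b) ⊎ (∃ λ s → s ∈⟨ D ⟩ × (a ≈ (s ⨾ b)))

GreenH : ∀ {n} → Digraph n → Transf n → Transf n → Set
GreenH D a b = (≤R D a b × ≤R D b a) × (≤L D a b × ≤L D b a)

HTrivial : ∀ {n} → Digraph n → Set
HTrivial D = ∀ a b → a ∈⟨ D ⟩ → b ∈⟨ D ⟩ → GreenH D a b → a ≈ b

Reach : ∀ {n} → Digraph n → Fin n → Fin n → Set
Reach D = Star (Arc D)

InComp : ∀ {n} → Digraph n → Fin n → Fin n → Set
InComp D v u = Reach D u v × Reach D v u

ComponentIsPath : ∀ {n} → Digraph n → Fin n → Set
ComponentIsPath {n} D v =
  Σ ℕ λ m → Σ (Fin m → Fin n) λ p →
      (∀ i j → p i ≡ p j → i ≡ j)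
    × (∀ u → InComp D v u ⇔ (∃ λ i → p i ≡ u))
    × (∀ i j → Arc D (p i) (p j) ⇔ ((toℕ j ≡ suc (toℕ i)) ⊎ (toℕ i ≡ suc (toℕ j))))

-- (⇐) Every element of ⟨D⟩ moves points along directed paths, and each
-- generator preserves the linear order of a path component on the points it
-- keeps inside it; hence so does every element (gen-monotone).  If a H b,
-- write a = b s, b = a t, b = u a.  Then t maps the image of a into itself,
-- injectively (s t is the identity there), keeping each point in its strong
-- component and preserving the path order.  An injective monotone partial
-- self-map of a finite chain is the identity (MonotoneSelfMap), so t fixes
-- the image of a and b = a t = a.
--
-- (⇒) H-triviality forbids every t ∈ ⟨D⟩ with t³ = t ≠ t², in particular
-- every element swapping two points and sending each point to itself or one
-- of them (noTransposition).  Explicit such elements rule out directed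
-- cycles of length ≥ 3 (noLongCycle), hence asymmetric arcs inside a strong
-- component (symmetricInComponent), and vertices with three neighbours
-- (noThreeNeighbours).  An induced path grown from v until its front cannot
-- be extended ends in a vertex e of degree ≤ 1; a second one grown from e
-- keeps every vertex behind its front saturated (OpenOnlyAtFront), so when
-- it stops it is the whole strong component of v.

module Submission where

open import Defs
open import Data.Nat as ℕ using (ℕ; zero; suc; _+_)
open import Data.Nat.Properties as ℕₚ using (n≤1+n; suc-injective; +-suc; +-identityʳ)
open import Data.Fin using (Fin; toℕ; inject₁; _≟_; _≤_; _<_) renaming (zero to fz; suc to fs)
open import Data.Fin.Properties using (toℕ-injective; any?; injective⇒≤; toℕ-inject₁; 0≢1+n; <-cmp; <-irrefl; ≤∧≢⇒<; ≤-reflexive)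
open import Data.Fin.Induction using (<-wellFounded; >-wellFounded)
open import Data.Bool using (true; false)
open import Data.Unit using (⊤; tt)
open import Data.Product using (Σ; _×_; _,_; ∃; proj₁; proj₂)
open import Data.Sum as Sum using (_⊎_; inj₁; inj₂)
open import Data.Empty using (⊥; ⊥-elim)
open import Relation.Nullary using (¬_; yes; no; Dec)
open import Relation.Nullary.Decidable using (_×-dec_; ¬?; decidable-stable)
open import Relation.Binary using (Rel; tri<; tri≈; tri>)
open import Relation.Binary.PropositionalEquality using (_≡_; refl; sym; trans; cong; subst; subst₂; _≢_; ≢-sym; module ≡-Reasoning)
open import Relation.Binary.Construct.Closure.ReflexiveTransitive using (Star; ε; _◅_; _◅◅_)
open import Induction.WellFounded using (WellFounded; Acc; acc)
open import Function using (_⇔_; Equivalence; mk⇔)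
open import Function.Construct.Composition using (_⇔-∘_)
import Data.Bool.Properties as Boolₚ

noInfiniteDescent : ∀ {a ℓ q} {A : Set a} {_≺_ : Rel A ℓ} → WellFounded _≺_ →
                    (Q : A → Set q) → (∀ {x} → Q x → ∃ λ y → y ≺ x × Q y) → ∀ x → ¬ Q x
noInfiniteDescent {_≺_ = _≺_} wf Q descend x = go (wf x)
  where
  go : ∀ {x} → Acc _≺_ x → ¬ Q x
  go (acc smaller) qx with descend qx
  ... | y , y≺x , qy = go (smaller y≺x) qy

-- An injective order-preserving self-map f of a subset S ⊆ Fin m fixes every
-- point of S: a point moved up (down) starts an orbit that rises (falls)
-- forever, which well-foundedness of > (<) on Fin m forbids.
module MonotoneSelfMap {m : ℕ} (S : Fin m → Set) (f : ∀ i → S i → Fin m)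
    (closed : ∀ {i} (si : S i) → S (f i si))
    (injective : ∀ {i j} (si : S i) (sj : S j) → f i si ≡ f j sj → i ≡ j)
    (monotone : ∀ {i j} (si : S i) (sj : S j) → i ≤ j → f i si ≤ f j sj) where

  MovedUp MovedDown : Fin m → Set
  MovedUp   i = Σ (S i) λ si → i < f i si
  MovedDown i = Σ (S i) λ si → f i si < i

  risesAgain : ∀ {i} → MovedUp i → ∃ λ j → i < j × MovedUp j
  risesAgain (si , i<fi) =
    _ , i<fi , closed si ,
    ≤∧≢⇒< (monotone si (closed si) (ℕₚ.<⇒≤ i<fi)) (λ e → <-irrefl (injective si (closed si) e) i<fi)

  fallsAgain : ∀ {i} → MovedDown i → ∃ λ j → j < i × MovedDown j
  fallsAgain (si , fi<i) =
    _ , fi<i , closed si ,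
    ≤∧≢⇒< (monotone (closed si) si (ℕₚ.<⇒≤ fi<i)) (λ e → <-irrefl (injective (closed si) si e) fi<i)

  fixes : ∀ {i} (si : S i) → f i si ≡ i
  fixes {i} si with <-cmp (f i si) i
  ... | tri< fi<i _ _ = ⊥-elim (noInfiniteDescent <-wellFounded MovedDown fallsAgain i (si , fi<i))
  ... | tri≈ _ fi≡i _ = fi≡i
  ... | tri> _ _ i<fi = ⊥-elim (noInfiniteDescent >-wellFounded MovedUp risesAgain i (si , i<fi))

member : ∀ {n} {D : Digraph n} {f} → Gen D f → f ∈⟨ D ⟩
member {f = f} g = f , g , λ _ → refl

∈-comp : ∀ {n} {D : Digraph n} {f g} → f ∈⟨ D ⟩ → g ∈⟨ D ⟩ → (f ⨾ g) ∈⟨ D ⟩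
∈-comp {g = g} (f′ , wf , f′≈f) (g′ , wg , g′≈g) =
  (f′ ⨾ g′) , comp wf wg , λ x → trans (g′≈g (f′ x)) (cong g (f′≈f x))

elem-≡ : ∀ {n} (a b : Fin n) → elem a b a ≡ b
elem-≡ a b with a ≟ a
... | yes _ = refl
... | no a≢a = ⊥-elim (a≢a refl)

elem-≢ : ∀ {n} {a : Fin n} b {x} → x ≢ a → elem a b x ≡ x
elem-≢ {a = a} b {x} x≢a with x ≟ a
... | yes x≡a = ⊥-elim (x≢a x≡a)
... | no _ = refl

elemCase : ∀ {n} (a b x : Fin n) → (x ≡ a × elem a b x ≡ b) ⊎ (x ≢ a × elem a b x ≡ x)
elemCase a b x with x ≟ a
... | yes x≡a = inj₁ (x≡a , refl)
... | no x≢a = inj₂ (x≢a , refl)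

-- Evaluating a word generator by generator: if the prefix sends u to v and the
-- next generator sends v to w, the longer prefix sends u to w.
infixl 5 _▷_
_▷_ : ∀ {n} {a b u v w : Fin n} → u ≡ v → elem a b v ≡ w → elem a b u ≡ w
u≡v ▷ h = trans (cong (elem _ _) u≡v) h

Adjacent : ∀ {m} → Fin m → Fin m → Set
Adjacent i j = (toℕ j ≡ suc (toℕ i)) ⊎ (toℕ i ≡ suc (toℕ j))

adjacent-shift : ∀ {m} {i j : Fin m} → Adjacent i j ⇔ Adjacent (fs i) (fs j)
adjacent-shift = mk⇔ (Sum.map (cong suc) (cong suc)) (Sum.map suc-injective suc-injective)

adjacent-front : ∀ {m} {j : Fin (suc m)} → Adjacent fz (fs j) ⇔ j ≡ fz
adjacent-front = mk⇔ (λ { (inj₁ e) → toℕ-injective (suc-injective e) ; (inj₂ ()) })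
                     (λ j≡0 → inj₁ (cong (λ k → suc (toℕ k)) j≡0))

OnPath : ∀ {n m} → (Fin m → Fin n) → Fin n → Set
OnPath p w = ∃ λ j → p j ≡ w

onPath? : ∀ {n m} (p : Fin m → Fin n) w → Dec (OnPath p w)
onPath? p w = any? (λ j → p j ≟ w)

cons : ∀ {a} {A : Set a} {m} → A → (Fin m → A) → Fin (suc m) → A
cons w p fz = w
cons w p (fs i) = p i

alongPath : ∀ {a ℓ} {A : Set a} {k} (q : Fin (suc k) → A) (T : Rel A ℓ) →
            (∀ i → T (q (inject₁ i)) (q (fs i))) → ∀ j → Star T (q fz) (q j)
alongPath q T steps fz = ε
alongPath {k = suc k} q T steps (fs j) = steps fz ◅ alongPath (λ i → q (fs i)) T (λ i → steps (fs i)) j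

module _ {n : ℕ} (D : Digraph n) where

  genReach : ∀ {f} → Gen D f → ∀ x → Reach D x (f x)
  genReach (gen {a} {b} ab) x with x ≟ a
  ... | yes refl = ab ◅ ε
  ... | no _ = ε
  genReach (comp {f} {g} wf wg) x = genReach wf x ◅◅ genReach wg (f x)

  memberReach : ∀ {t} → t ∈⟨ D ⟩ → ∀ x → Reach D x (t x)
  memberReach (f , wf , f≈t) x = subst (Reach D x) (f≈t x) (genReach wf x)

  convex : ∀ {c x y z} → InComp D c x → InComp D c z → Reach D x y → Reach D y z → InComp D c y
  convex (_ , c→x) (z→c , _) x→y y→z = y→z ◅◅ z→c , c→x ◅◅ x→y

  module PathOrder (c : Fin n) {m : ℕ} (p : Fin m → Fin n)
      (inj : ∀ i j → p i ≡ p j → i ≡ j)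
      (cov : ∀ u → InComp D c u ⇔ (∃ λ i → p i ≡ u))
      (exact : ∀ i j → Arc D (p i) (p j) ⇔ Adjacent i j) where

    onPath : ∀ i → InComp D c (p i)
    onPath i = Equivalence.from (cov (p i)) (i , refl)

    position : ∀ {u} → InComp D c u → ∃ λ k → p k ≡ u
    position {u} = Equivalence.to (cov u)

    arcStep : ∀ {i j} → Arc D (p i) (p j) → toℕ j ℕ.≤ suc (toℕ i) × toℕ i ℕ.≤ suc (toℕ j)
    arcStep {i} {j} ij with Equivalence.to (exact i j) ij
    ... | inj₁ j≡1+i rewrite j≡1+i = ℕₚ.≤-refl , ℕₚ.≤-trans (n≤1+n _) (n≤1+n _)
    ... | inj₂ i≡1+j rewrite i≡1+j = ℕₚ.≤-trans (n≤1+n _) (n≤1+n _) , ℕₚ.≤-refl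

    -- A generator preserves the order of the points it keeps on the path:
    -- it only moves the point a, by one step.
    elem-monotone : ∀ {a b} → Arc D a b → ∀ {i j i′ j′} → i ≤ j →
                    elem a b (p i) ≡ p i′ → elem a b (p j) ≡ p j′ → i′ ≤ j′
    elem-monotone {a} {b} ab {i} {j} {i′} {j′} i≤j hi hj with elemCase a b (p i) | elemCase a b (p j)
    ... | inj₁ (_ , ei) | inj₁ (_ , ej) =
      ≤-reflexive (inj i′ j′ (trans (sym hi) (trans ei (trans (sym ej) hj))))
    ... | inj₁ (pi≡a , ei) | inj₂ (pj≢a , ej) =
      subst (i′ ≤_) (inj j j′ (trans (sym ej) hj))
            (ℕₚ.≤-trans (proj₁ (arcStep (subst₂ (Arc D) (sym pi≡a) (trans (sym ei) hi) ab))) i<j)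
      where
      i<j : i < j
      i<j = ≤∧≢⇒< i≤j (λ i≡j → pj≢a (trans (cong p (sym i≡j)) pi≡a))
    ... | inj₂ (pi≢a , ei) | inj₁ (pj≡a , ej) =
      subst (_≤ j′) (inj i i′ (trans (sym ei) hi))
            (ℕₚ.≤-pred (ℕₚ.≤-trans i<j (proj₂ (arcStep (subst₂ (Arc D) (sym pj≡a) (trans (sym ej) hj) ab)))))
      where
      i<j : i < j
      i<j = ≤∧≢⇒< i≤j (λ i≡j → pi≢a (trans (cong p i≡j) pj≡a))
    ... | inj₂ (_ , ei) | inj₂ (_ , ej) =
      subst₂ _≤_ (inj i i′ (trans (sym ei) hi)) (inj j j′ (trans (sym ej) hj)) i≤j

    midpoint : ∀ {f g} → Gen D f → Gen D g → ∀ {i i′} → g (f (p i)) ≡ p i′ → ∃ λ k → p k ≡ f (p i)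
    midpoint {f} wf wg {i} {i′} hi =
      position (convex (onPath i) (onPath i′) (genReach wf (p i))
                       (subst (Reach D (f (p i))) hi (genReach wg (f (p i)))))

    -- Hence every element of ⟨D⟩ preserves the order on the points it keeps
    -- on the path; for a product, the intermediate points stay on it too.
    gen-monotone : ∀ {f} → Gen D f → ∀ {i j i′ j′} → i ≤ j → f (p i) ≡ p i′ → f (p j) ≡ p j′ → i′ ≤ j′
    gen-monotone (gen ab) = elem-monotone ab
    gen-monotone (comp {f} {g} wf wg) i≤j hi hj with midpoint wf wg hi | midpoint wf wg hj
    ... | k , pk≡ | l , pl≡ =
      gen-monotone wg (gen-monotone wf i≤j (sym pk≡) (sym pl≡))
                   (trans (cong g pk≡) hi) (trans (cong g pl≡) hj)

  Image : Transf n → Fin n → Set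
  Image a z = ∃ λ x → a x ≡ z

  module RelatedPair {a b s t u : Transf n} (s∈ : s ∈⟨ D ⟩) (t∈ : t ∈⟨ D ⟩)
      (a≈bs : ∀ x → a x ≡ s (b x)) (b≈at : ∀ x → b x ≡ t (a x)) (b≈ua : ∀ x → b x ≡ a (u x)) where

    t-image : ∀ {z} → Image a z → Image a (t z)
    t-image (x , refl) = u x , trans (sym (b≈ua x)) (b≈at x)

    s-retracts : ∀ {z} → Image a z → s (t z) ≡ z
    s-retracts (x , refl) = trans (cong s (sym (b≈at x))) (sym (a≈bs x))

    t-fixes : (∀ v → ComponentIsPath D v) → ∀ {z} → Image a z → t z ≡ z
    t-fixes paths {z} imz with paths z
    ... | m , p , inj , cov , exact = begin
          t z         ≡⟨ cong t (sym pi≡z) ⟩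
          t (p i)     ≡⟨ sym (image-spec si) ⟩
          p (f i si)  ≡⟨ cong p (MonotoneSelfMap.fixes S f closed injective monotone si) ⟩
          p i         ≡⟨ pi≡z ⟩
          z           ∎
      where
      open ≡-Reasoning
      open PathOrder z p inj cov exact

      S : Fin m → Set
      S i = Image a (p i)

      stays : ∀ {i} → S i → InComp D z (t (p i))
      stays {i} si = convex (onPath i) (onPath i) (memberReach t∈ (p i))
                            (subst (Reach D (t (p i))) (s-retracts si) (memberReach s∈ (t (p i))))

      f : ∀ i → S i → Fin m
      f i si = proj₁ (position (stays si))

      image-spec : ∀ {i} (si : S i) → p (f i si) ≡ t (p i)
      image-spec si = proj₂ (position (stays si))

      closed : ∀ {i} (si : S i) → S (f i si)
      closed si = subst (Image a) (sym (image-spec si)) (t-image si)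

      injective : ∀ {i j} (si : S i) (sj : S j) → f i si ≡ f j sj → i ≡ j
      injective {i} {j} si sj fi≡fj = inj i j (begin
        p i              ≡⟨ sym (s-retracts si) ⟩
        s (t (p i))      ≡⟨ cong s (sym (image-spec si)) ⟩
        s (p (f i si))   ≡⟨ cong (λ k → s (p k)) fi≡fj ⟩
        s (p (f j sj))   ≡⟨ cong s (image-spec sj) ⟩
        s (t (p j))      ≡⟨ s-retracts sj ⟩
        p j              ∎)

      monotone : ∀ {i j} (si : S i) (sj : S j) → i ≤ j → f i si ≤ f j sj
      monotone {i} {j} si sj i≤j =
        gen-monotone (proj₁ (proj₂ t∈)) i≤j (trans (proj₂ (proj₂ t∈) (p i)) (sym (image-spec si)))
                                           (trans (proj₂ (proj₂ t∈) (p j)) (sym (image-spec sj)))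

      i : Fin m
      i = proj₁ (position {z} (ε , ε))

      pi≡z : p i ≡ z
      pi≡z = proj₂ (position {z} (ε , ε))

      si : S i
      si = subst (Image a) (sym pi≡z) imz

  hTrivialOfPaths : (∀ v → ComponentIsPath D v) → HTrivial D
  hTrivialOfPaths paths a b _ _ ((inj₁ a≈b , _) , _) = a≈b
  hTrivialOfPaths paths a b _ _ ((inj₂ _ , inj₁ b≈a) , _) = λ x → sym (b≈a x)
  hTrivialOfPaths paths a b _ _ ((inj₂ _ , inj₂ _) , (_ , inj₁ b≈a)) = λ x → sym (b≈a x)
  hTrivialOfPaths paths a b _ _ ((inj₂ (s , s∈ , a≈bs) , inj₂ (t , t∈ , b≈at)) , (_ , inj₂ (u , _ , b≈ua))) x =
    trans (sym (t-fixes paths (x , refl))) (sym (b≈at x))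
    where open RelatedPair s∈ t∈ a≈bs b≈at b≈ua

  arc≢ : ∀ {x y} → Arc D x y → x ≢ y
  arc≢ {x} xy refl with trans (sym xy) (Digraph.noLoops D x)
  ... | ()

  Edge : Fin n → Fin n → Set
  Edge x y = Arc D x y × Arc D y x

  edge? : ∀ x y → Dec (Edge x y)
  edge? x y = (Digraph.adj D x y Boolₚ.≟ true) ×-dec (Digraph.adj D y x Boolₚ.≟ true)

  Avoiding : Fin n → Fin n → Fin n → Set
  Avoiding a x y = Arc D x y × y ≢ a

  sweep : ∀ {a x z} → Star (Avoiding a) x z → Transf n
  sweep ε = λ u → u
  sweep {x = x} (_◅_ {j = y} _ w) = elem x y ⨾ sweep w

  sweepThen : ∀ {a x z r} (w : Star (Avoiding a) x z) → Gen D r → Gen D (sweep w ⨾ r)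
  sweepThen ε g = g
  sweepThen (xy ◅ w) g = comp (gen (proj₁ xy)) (sweepThen w g)

  sweep-start : ∀ {a x z} (w : Star (Avoiding a) x z) → sweep w x ≡ z
  sweep-start ε = refl
  sweep-start {x = x} (_◅_ {j = y} _ w) = trans (cong (sweep w) (elem-≡ x y)) (sweep-start w)

  sweep-fixes : ∀ {a x z} → x ≢ a → (w : Star (Avoiding a) x z) → sweep w a ≡ a
  sweep-fixes x≢a ε = refl
  sweep-fixes x≢a (_◅_ {j = y} (_ , y≢a) w) = trans (cong (sweep w) (elem-≢ y (≢-sym x≢a))) (sweep-fixes y≢a w)

  sweep-range : ∀ {a x z} (w : Star (Avoiding a) x z) → ∀ u → sweep w u ≡ u ⊎ sweep w u ≡ z
  sweep-range ε u = inj₁ refl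
  sweep-range {x = x} (_◅_ {j = y} _ w) u with elemCase x y u
  ... | inj₁ (_ , moved) = inj₂ (trans (cong (sweep w) moved) (sweep-start w))
  ... | inj₂ (_ , fixed) = Sum.map (trans (cong (sweep w) fixed)) (trans (cong (sweep w) fixed)) (sweep-range w u)

  endAvoids : ∀ {a x z} → x ≢ a → Star (Avoiding a) x z → z ≢ a
  endAvoids x≢a ε = x≢a
  endAvoids _ ((_ , y≢a) ◅ w) = endAvoids y≢a w

  firstHit : ∀ {x u} → x ≢ u → Reach D x u → ∃ λ z → Star (Avoiding u) x z × Arc D z u
  firstHit x≢u ε = ⊥-elim (x≢u refl)
  firstHit {x} {u} x≢u (_◅_ {j = y} xy rest) with y ≟ u
  ... | yes refl = x , ε , xy
  ... | no y≢u with firstHit y≢u rest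
  ...   | z , w , zu = z , (xy , y≢u) ◅ w , zu

  module _ (H : HTrivial D) where

    -- t³ = t makes t and t² H-related, so t is idempotent.
    cube⇒idempotent : ∀ {t} → t ∈⟨ D ⟩ → (∀ x → t (t (t x)) ≡ t x) → ∀ x → t (t x) ≡ t x
    cube⇒idempotent {t} t∈ cube x = sym (H t (t ⨾ t) t∈ (∈-comp t∈ t∈) (bothR , bothL) x)
      where
      bothR : ≤R D t (t ⨾ t) × ≤R D (t ⨾ t) t
      bothR = inj₂ (t , t∈ , λ x → sym (cube x)) , inj₂ (t , t∈ , λ _ → refl)
      bothL : ≤L D t (t ⨾ t) × ≤L D (t ⨾ t) t
      bothL = inj₂ (t , t∈ , λ x → sym (cube x)) , inj₂ (t , t∈ , λ _ → refl)

    -- No element of ⟨D⟩ swaps two points while sending every point to itself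
    -- or to one of them: such an element satisfies t³ = t but not t² = t.
    noTransposition : ∀ {t} → t ∈⟨ D ⟩ → ∀ {p q} → p ≢ q → t p ≡ q → t q ≡ p →
                      (∀ w → t w ≡ w ⊎ t w ≡ p ⊎ t w ≡ q) → ⊥
    noTransposition {t} t∈ {p} {q} p≢q tp tq range = p≢q (begin
      p          ≡⟨ sym tq ⟩
      t q        ≡⟨ cong t (sym tp) ⟩
      t (t p)    ≡⟨ cube⇒idempotent t∈ cube p ⟩
      t p        ≡⟨ tp ⟩
      q          ∎)
      where
      open ≡-Reasoning
      cube : ∀ x → t (t (t x)) ≡ t x
      cube x with range x
      ... | inj₁ tx≡x = trans (cong (λ y → t (t y)) tx≡x) (cong t tx≡x)
      ... | inj₂ (inj₁ tx≡p) = trans (cong (λ y → t (t y)) tx≡p) (trans (cong t tp) (trans tq (sym tx≡p)))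
      ... | inj₂ (inj₂ tx≡q) = trans (cong (λ y → t (t y)) tx≡q) (trans (cong t tq) (trans tp (sym tx≡q)))

    -- No directed cycle a → b ⇝ z → a of length ≥ 3: the word
    -- (sweep of b ⇝ z)(a → b)(z → a) would swap a and b.
    noLongCycle : ∀ {a b z} → Arc D a b → Star (Avoiding a) b z → b ≢ z → Arc D z a → ⊥
    noLongCycle {a} {b} {z} ab w b≢z za =
      noTransposition (member (sweepThen w (comp (gen ab) (gen za)))) (arc≢ ab) ta tb range
      where
      b≢a : b ≢ a
      b≢a = ≢-sym (arc≢ ab)
      z≢a : z ≢ a
      z≢a = endAvoids b≢a w
      ta : elem z a (elem a b (sweep w a)) ≡ b
      ta = sweep-fixes b≢a w ▷ elem-≡ a b ▷ elem-≢ a b≢z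
      tb : elem z a (elem a b (sweep w b)) ≡ a
      tb = sweep-start w ▷ elem-≢ b z≢a ▷ elem-≡ z a
      range : ∀ u → let tu = elem z a (elem a b (sweep w u)) in tu ≡ u ⊎ tu ≡ a ⊎ tu ≡ b
      range u with sweep-range w u
      ... | inj₂ su≡z = inj₂ (inj₁ (su≡z ▷ elem-≢ b z≢a ▷ elem-≡ z a))
      ... | inj₁ su≡u with elemCase a b u
      ...   | inj₁ (_ , moved) = inj₂ (inj₂ (su≡u ▷ moved ▷ elem-≢ a b≢z))
      ...   | inj₂ (_ , fixed) with elemCase z a u
      ...     | inj₁ (_ , moved′) = inj₂ (inj₁ (su≡u ▷ fixed ▷ moved′))
      ...     | inj₂ (_ , fixed′) = inj₁ (su≡u ▷ fixed ▷ fixed′)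

    -- Inside a strong component every arc is reversed by an arc: otherwise the
    -- way back closes a cycle of length ≥ 3.
    symmetricInComponent : ∀ {u w} → Arc D u w → Reach D w u → Arc D w u
    symmetricInComponent {u} {w} uw w⇝u with Digraph.adj D w u in wu
    ... | true = refl
    ... | false with firstHit (≢-sym (arc≢ uw)) w⇝u
    ...   | z , walk , zu = ⊥-elim (noLongCycle uw walk w≢z zu)
      where
      w≢z : w ≢ z
      w≢z refl with trans (sym zu) wu
      ... | ()

    -- No vertex c has three distinct neighbours x, y, z: the word
    -- (c → x)(y → c)(c → z)(x → c)(c → y)(z → c) would swap c and y.
    noThreeNeighbours : ∀ {c x y z} → Edge c x → Edge c y → Edge c z → x ≢ y → x ≢ z → y ≢ z → ⊥
    noThreeNeighbours {c} {x} {y} {z} (cx , xc) (cy , yc) (cz , zc) x≢y x≢z y≢z =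
      noTransposition (member word) (≢-sym y≢c) tc ty range
      where
      T : Transf n
      T u = elem z c (elem c y (elem x c (elem c z (elem y c (elem c x u)))))
      word : Gen D T
      word = comp (gen cx) (comp (gen yc) (comp (gen cz) (comp (gen xc) (comp (gen cy) (gen zc)))))
      x≢c : x ≢ c
      x≢c = ≢-sym (arc≢ cx)
      y≢c : y ≢ c
      y≢c = ≢-sym (arc≢ cy)
      z≢c : z ≢ c
      z≢c = ≢-sym (arc≢ cz)
      tc : T c ≡ y
      tc = elem-≡ c x ▷ elem-≢ c x≢y ▷ elem-≢ z x≢c ▷ elem-≡ x c ▷ elem-≡ c y ▷ elem-≢ c y≢z
      ty : T y ≡ c
      ty = elem-≢ x y≢c ▷ elem-≡ y c ▷ elem-≡ c z ▷ elem-≢ c (≢-sym x≢z) ▷ elem-≢ y z≢c ▷ elem-≡ z c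
      tx : T x ≡ y
      tx = elem-≢ x x≢c ▷ elem-≢ c x≢y ▷ elem-≢ z x≢c ▷ elem-≡ x c ▷ elem-≡ c y ▷ elem-≢ c y≢z
      tz : T z ≡ c
      tz = elem-≢ x z≢c ▷ elem-≢ c (≢-sym y≢z) ▷ elem-≢ z z≢c ▷ elem-≢ c (≢-sym x≢z) ▷ elem-≢ y z≢c ▷ elem-≡ z c
      Other : Fin n → Set
      Other u = u ≢ c × u ≢ x × u ≢ y × u ≢ z
      classify : ∀ u → u ≡ c ⊎ u ≡ x ⊎ u ≡ y ⊎ u ≡ z ⊎ Other u
      classify u with u ≟ c | u ≟ x | u ≟ y | u ≟ z
      ... | yes u≡c | _ | _ | _ = inj₁ u≡c
      ... | no _ | yes u≡x | _ | _ = inj₂ (inj₁ u≡x)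
      ... | no _ | no _ | yes u≡y | _ = inj₂ (inj₂ (inj₁ u≡y))
      ... | no _ | no _ | no _ | yes u≡z = inj₂ (inj₂ (inj₂ (inj₁ u≡z)))
      ... | no u≢c | no u≢x | no u≢y | no u≢z = inj₂ (inj₂ (inj₂ (inj₂ (u≢c , u≢x , u≢y , u≢z))))
      range : ∀ u → T u ≡ u ⊎ T u ≡ c ⊎ T u ≡ y
      range u with classify u
      ... | inj₁ u≡c = inj₂ (inj₂ (trans (cong T u≡c) tc))
      ... | inj₂ (inj₁ u≡x) = inj₂ (inj₂ (trans (cong T u≡x) tx))
      ... | inj₂ (inj₂ (inj₁ u≡y)) = inj₂ (inj₁ (trans (cong T u≡y) ty))
      ... | inj₂ (inj₂ (inj₂ (inj₁ u≡z))) = inj₂ (inj₁ (trans (cong T u≡z) tz))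
      ... | inj₂ (inj₂ (inj₂ (inj₂ (u≢c , u≢x , u≢y , u≢z)))) =
        inj₁ (elem-≢ x u≢c ▷ elem-≢ c u≢y ▷ elem-≢ z u≢c ▷ elem-≢ c u≢x ▷ elem-≢ y u≢c ▷ elem-≢ c u≢z)

    module Growth (v : Fin n) where

      flipArc : ∀ {x y} → InComp D v x → InComp D v y → Arc D x y → Arc D y x
      flipArc cx cy xy = symmetricInComponent xy (proj₁ cy ◅◅ proj₂ cx)

      edgeInComp : ∀ {x w} → InComp D v x → Edge x w → InComp D v w
      edgeInComp (x⇝v , v⇝x) (xw , wx) = wx ◅ x⇝v , v⇝x ◅◅ (xw ◅ ε)

      record InducedPath {m : ℕ} (p : Fin (suc m) → Fin n) : Set where
        field
          injective   : ∀ i j → p i ≡ p j → i ≡ j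
          inComponent : ∀ i → InComp D v (p i)
          exact       : ∀ i j → Arc D (p i) (p j) ⇔ Adjacent i j

      single : ∀ {x} → InComp D v x → InducedPath {0} (λ _ → x)
      single cx = record
        { injective   = λ { fz fz _ → refl }
        ; inComponent = λ _ → cx
        ; exact       = λ { fz fz → mk⇔ (λ xx → ⊥-elim (arc≢ xx refl)) (λ { (inj₁ ()) ; (inj₂ ()) }) }
        }

      -- A neighbour w of the front that is off the path can be prepended: an
      -- arc from w to a later entry would close a cycle of length ≥ 3.
      prepend : ∀ {m} {p : Fin (suc m) → Fin n} → InducedPath p →
                ∀ {w} → Edge (p fz) w → ¬ OnPath p w → InducedPath (cons w p)
      prepend {m} {p} ip {w} (pw , wp) w∉ = record
        { injective = injective′ ; inComponent = inComponent′ ; exact = exact′ }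
        where
        open InducedPath ip
        cw : InComp D v w
        cw = edgeInComp (inComponent fz) (pw , wp)
        injective′ : ∀ i j → cons w p i ≡ cons w p j → i ≡ j
        injective′ fz fz _ = refl
        injective′ fz (fs j) e = ⊥-elim (w∉ (j , sym e))
        injective′ (fs i) fz e = ⊥-elim (w∉ (i , e))
        injective′ (fs i) (fs j) e = cong fs (injective i j e)
        inComponent′ : ∀ i → InComp D v (cons w p i)
        inComponent′ fz = cw
        inComponent′ (fs i) = inComponent i
        pathStep : ∀ (i : Fin m) → Avoiding w (p (inject₁ i)) (p (fs i))
        pathStep i = Equivalence.from (exact (inject₁ i) (fs i)) (inj₁ (cong suc (sym (toℕ-inject₁ i))))
                   , λ e → w∉ (fs i , e)
        onlyFront : ∀ j → ¬ Arc D w (p (fs j))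
        onlyFront j wpj = noLongCycle wp (alongPath p (Avoiding w) pathStep (fs j))
                                      (λ e → 0≢1+n (injective fz (fs j) e))
                                      (flipArc cw (inComponent (fs j)) wpj)
        fromFront : ∀ j → Arc D w (p j) ⇔ Adjacent fz (fs j)
        fromFront fz = mk⇔ (λ _ → inj₁ refl) (λ _ → wp)
        fromFront (fs j) = mk⇔ (λ wpj → ⊥-elim (onlyFront j wpj))
                               (λ adj → ⊥-elim (0≢1+n (sym (Equivalence.to adjacent-front adj))))
        exact′ : ∀ i j → Arc D (cons w p i) (cons w p j) ⇔ Adjacent i j
        exact′ fz fz = mk⇔ (λ ww → ⊥-elim (arc≢ ww refl)) (λ { (inj₁ ()) ; (inj₂ ()) })
        exact′ fz (fs j) = fromFront j
        exact′ (fs i) fz = mk⇔ (λ piw → Sum.swap (Equivalence.to (fromFront i) (flipArc (inComponent i) cw piw)))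
                               (λ adj → flipArc cw (inComponent i) (Equivalence.from (fromFront i) (Sum.swap adj)))
        exact′ (fs i) (fs j) = adjacent-shift ⇔-∘ exact i j

      Invariant : Set₁
      Invariant = ∀ {m} → (Fin (suc m) → Fin n) → Set

      Preserved : Invariant → Set
      Preserved Inv = ∀ {m} {p : Fin (suc m) → Fin n} → InducedPath p → Inv p →
                      ∀ {w} → Edge (p fz) w → ¬ OnPath p w → Inv (cons w p)

      record Maximal (Inv : Invariant) : Set where
        field
          len       : ℕ
          path      : Fin (suc len) → Fin n
          induced   : InducedPath path
          invariant : Inv path
          saturated : ∀ w → Edge (path fz) w → OnPath path w

      -- Prepending neighbours terminates: an induced path has at most n entries.
      grow : ∀ (Inv : Invariant) → Preserved Inv → ∀ k {m} (p : Fin (suc m) → Fin n) →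
             InducedPath p → Inv p → n ℕ.≤ suc m + k → Maximal Inv
      grow Inv preserved k {m} p ip inv bound with any? (λ w → edge? (p fz) w ×-dec ¬? (onPath? p w))
      ... | no stuck = record
        { len = m ; path = p ; induced = ip ; invariant = inv
        ; saturated = λ w e → decidable-stable (onPath? p w) (λ w∉ → stuck (w , e , w∉)) }
      ... | yes (w , e , w∉) with k
      ...   | zero = ⊥-elim (ℕₚ.<-irrefl refl (ℕₚ.≤-trans longer (subst (n ℕ.≤_) (+-identityʳ (suc m)) bound)))
        where
        longer : suc (suc m) ℕ.≤ n
        longer = injective⇒≤ (λ {i} {j} → InducedPath.injective (prepend ip e w∉) i j)
      ...   | suc k′ = grow Inv preserved k′ (cons w p) (prepend ip e w∉) (preserved ip inv e w∉)
                            (subst (n ℕ.≤_) (+-suc (suc m) k′) bound)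

      growFrom : ∀ (Inv : Invariant) → Preserved Inv → ∀ {x} → InComp D v x → Inv {0} (λ _ → x) → Maximal Inv
      growFrom Inv preserved cx inv = grow Inv preserved n _ (single cx) inv (n≤1+n n)

      first : Maximal (λ _ → ⊤)
      first = growFrom (λ _ → ⊤) (λ _ _ _ _ → tt) (ε , ε) tt

      e : Fin n
      e = Maximal.path first fz

      e∈ : InComp D v e
      e∈ = InducedPath.inComponent (Maximal.induced first) fz

      -- Maximality puts every neighbour of e on the path, hence at position 1.
      neighbourOfEnd : ∀ {w} → Edge e w → ∃ λ j → Maximal.path first j ≡ w × toℕ j ≡ 1
      neighbourOfEnd {w} ew with Maximal.saturated first w ew
      ... | j , pj≡w with Equivalence.to (InducedPath.exact (Maximal.induced first) fz j)
                                         (subst (Arc D e) (sym pj≡w) (proj₁ ew))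
      ...   | inj₁ j≡1 = j , pj≡w , j≡1
      ...   | inj₂ ()

      endDegree≤1 : ∀ {w w′} → Edge e w → Edge e w′ → w ≡ w′
      endDegree≤1 ew ew′ with neighbourOfEnd ew | neighbourOfEnd ew′
      ... | j , pj≡w , j≡1 | j′ , pj′≡w′ , j′≡1 =
        trans (sym pj≡w) (trans (cong (Maximal.path first) (toℕ-injective (trans j≡1 (sym j′≡1)))) pj′≡w′)

      record OpenOnlyAtFront {m : ℕ} (p : Fin (suc m) → Fin n) : Set where
        field
          behind : ∀ i w → Edge (p (fs i)) w → OnPath p w
          front  : ∀ w w′ → Edge (p fz) w → Edge (p fz) w′ → OnPath p w ⊎ OnPath p w′ ⊎ w ≡ w′

      -- Prepending the front's unique outside neighbour y keeps this: y has the
      -- old front as a neighbour, so at most one more off the path.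
      openOnlyAtFront-preserved : Preserved OpenOnlyAtFront
      openOnlyAtFront-preserved {p = p} ip inv {y} py y∉ = record { behind = behind′ ; front = front′ }
        where
        open OpenOnlyAtFront inv
        extend : ∀ {w} → OnPath p w → OnPath (cons y p) w
        extend (j , pj≡w) = fs j , pj≡w
        behind′ : ∀ i w → Edge (cons y p (fs i)) w → OnPath (cons y p) w
        behind′ fz w pw with front w y pw py
        ... | inj₁ w∈ = extend w∈
        ... | inj₂ (inj₁ y∈) = ⊥-elim (y∉ y∈)
        ... | inj₂ (inj₂ w≡y) = fz , sym w≡y
        behind′ (fs i) w piw = extend (behind i w piw)
        front′ : ∀ w w′ → Edge y w → Edge y w′ → OnPath (cons y p) w ⊎ OnPath (cons y p) w′ ⊎ w ≡ w′
        front′ w w′ yw yw′ with onPath? (cons y p) w | onPath? (cons y p) w′ | w ≟ w′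
        ... | yes w∈ | _ | _ = inj₁ w∈
        ... | no _ | yes w′∈ | _ = inj₂ (inj₁ w′∈)
        ... | no _ | no _ | yes w≡w′ = inj₂ (inj₂ w≡w′)
        ... | no w∉ | no w′∉ | no w≢w′ =
          ⊥-elim (noThreeNeighbours (proj₂ py , proj₁ py) yw yw′
                   (λ e → w∉ (fs fz , e)) (λ e → w′∉ (fs fz , e)) w≢w′)

      openOnlyAtFront-end : OpenOnlyAtFront {0} (λ _ → e)
      openOnlyAtFront-end = record
        { behind = λ ()
        ; front  = λ w w′ ew ew′ → inj₂ (inj₂ (endDegree≤1 ew ew′)) }

      second : Maximal OpenOnlyAtFront
      second = growFrom OpenOnlyAtFront openOnlyAtFront-preserved e∈ openOnlyAtFront-end

      open Maximal second
      open InducedPath induced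

      closed : ∀ i w → Edge (path i) w → OnPath path w
      closed fz = saturated
      closed (fs i) = OpenOnlyAtFront.behind invariant i

      walkStaysOnPath : ∀ {x u} → OnPath path x → Reach D x u → Reach D u v → OnPath path u
      walkStaysOnPath x∈ ε _ = x∈
      walkStaysOnPath {x} (i , pi≡x) (_◅_ {j = y} xy y⇝u) u⇝v =
        walkStaysOnPath (closed i y (subst (λ z → Edge z y) (sym pi≡x) (xy , yx))) y⇝u u⇝v
        where
        cx : InComp D v x
        cx = subst (InComp D v) pi≡x (inComponent i)
        yx : Arc D y x
        yx = flipArc cx (y⇝u ◅◅ u⇝v , proj₂ cx ◅◅ (xy ◅ ε)) xy

      -- Every vertex of the component is reached from e inside it, so lies on the path.
      componentIsPath : ComponentIsPath D v
      componentIsPath = suc len , path , injective , covers , exact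
        where
        covers : ∀ u → InComp D v u ⇔ OnPath path u
        covers u = mk⇔ (λ { (u⇝v , v⇝u) → walkStaysOnPath (fz , refl) (proj₁ (inComponent fz) ◅◅ v⇝u) u⇝v })
                       (λ { (j , pj≡u) → subst (InComp D v) pj≡u (inComponent j) })

proposition3p1 : ∀ {n : ℕ} (D : Digraph n) →
    HTrivial D ⇔ (∀ (v : Fin n) → ComponentIsPath D v)
proposition3p1 D = mk⇔ (λ H v → Growth.componentIsPath D H v) (hTrivialOfPaths D)
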